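{- Let $\mathcal{C}$ be the double Spitzer Hopf algebra described in the context. Its antipode $S$ satisfies, for every $n\ge0$, $$S\big((\rho X)^{[n]}X\big)=-X(\tilde\rho X)^{\{n\}},$$ where $\tilde\rho:=-\mathrm{id}-\rho$, $(\tilde\rho X)^{\{0\}}=1$ and $(\tilde\rho X)^{\{m+1\}}=\tilde\rho\big(X(\tilde\rho X)^{\{m\}}\big)$.
   Context: $\mathbb{K}$ is a field of characteristic zero; $T(X)$ is the free associative unital $\mathbb{K}$-algebra on countably many noncommuting variables $x_1,x_2,\dots$; $\mathcal{A}$ is the algebra of sequences $(y_1,y_2,\dots)$ of elements of $T(X)$ with componentwise operations; $\rho(y_1,y_2,\dots)=(0,y_1,y_1+y_2,y_1+y_2+y_3,\dots)$ (a weight-$1$ Rota–Baxter operator); $X=(x_1,x_2,\dots)\in\mathcal{A}$. Set $(\rho X)^{[0]}=1$, $(\rho X)^{[n+1]}=\rho\big((\rho X)^{[n]}X\big)$, so $(\rho X)^{[0]}X=X$. The double product on $\mathcal{A}$ is $a\ast_\rho b=\rho(a)b+a\rho(b)+ab$ (associative). The double Spitzer algebra $\mathcal{C}$ is the algebra for $\ast_\rho$ freely generated by the elements $(\rho X)^{[n]}X$, $n\ge0$ (a unit $1$ being adjoined), made into a graded connected cocommutative Hopf algebra by declaring $(\rho X)^{[n]}X$ of degree $n+1$, using the convention $(\rho X)^{[-1]}X:=1$, and setting $\Delta_*\big((\rho X)^{[n]}X\big)=1\otimes(\rho X)^{[n]}X+\sum_{m=0}^{n-1}(\rho X)^{[n-m-1]}X\otimes(\rho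 X)^{[m]}X+(\rho X)^{[n]}X\otimes1$. -}

module Defs where

open import Level using (_⊔_)
open import Algebra.Bundles using (CommutativeRing)
open import Data.Nat as ℕ using (ℕ; zero; suc; _∸_)
open import Data.List using (List; []; _∷_; _++_; map; concatMap)
open import Data.List.Properties using (≡-dec)
open import Data.Product using (_×_; _,_; Σ)
open import Relation.Nullary using (¬_; yes; no)
open import Relation.Binary.PropositionalEquality using (_≡_)

module _ {c ℓ} (K : CommutativeRing c ℓ) where
  open CommutativeRing K

  IsFieldCR : Set (c ⊔ ℓ)
  IsFieldCR = (¬ (1# ≈ 0#)) × (∀ x → ¬ (x ≈ 0#) → Σ Carrier λ y → (x * y) ≈ 1#)

  natMul : ℕ → Carrier
  natMul zero = 0#
  natMul (suc n) = 1# + natMul n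

  CharZero : Set ℓ
  CharZero = ∀ n → natMul n ≈ 0# → n ≡ 0

module Spitzer {c ℓ} (K : CommutativeRing c ℓ) where
  open CommutativeRing K

  -- words in the noncommuting variables; the natural number i stands for x_{i+1}
  Word : Set
  Word = List ℕ

  -- T(X): noncommutative polynomials as finite formal sums of (coefficient, word),
  -- compared by their coefficient functions (see coeff / _≈P_)
  Poly : Set c
  Poly = List (Carrier × Word)

  coeff : Poly → Word → Carrier
  coeff [] w = 0#
  coeff ((a , u) ∷ p) w with ≡-dec ℕ._≟_ u w
  ... | yes _ = a + coeff p w
  ... | no  _ = coeff p w

  _≈P_ : Poly → Poly → Set (ℓ)
  p ≈P q = ∀ w → coeff p w ≈ coeff q w

  0P 1P : Poly
  0P = []
  1P = (1# , []) ∷ []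

  var : ℕ → Poly
  var i = (1# , i ∷ []) ∷ []

  _+P_ : Poly → Poly → Poly
  p +P q = p ++ q

  -P_ : Poly → Poly
  -P p = map (λ { (a , u) → (- a , u) }) p

  _*P_ : Poly → Poly → Poly
  p *P q = concatMap (λ { (a , u) → map (λ { (b , v) → (a * b , u ++ v) }) q }) p

  -- 𝒜: sequences of elements of T(X), indexed from 0 (component k = y_{k+1})
  Seq : Set c
  Seq = ℕ → Poly

  _≈S_ : Seq → Seq → Set ℓ
  a ≈S b = ∀ k → a k ≈P b k

  0S 1S : Seq
  0S k = 0P
  1S k = 1P

  _+S_ _*S_ : Seq → Seq → Seq
  (a +S b) k = a k +P b k
  (a *S b) k = a k *P b k

  -S_ : Seq → Seq
  (-S a) k = -P (a k)

  infixl 6 _+S_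
  infixl 7 _*S_

  ρ : Seq → Seq
  ρ y zero = 0P
  ρ y (suc k) = ρ y k +P y k

  𝕏 : Seq
  𝕏 k = var k

  ρpow : ℕ → Seq
  ρpow zero = 1S
  ρpow (suc n) = ρ (ρpow n *S 𝕏)

  gen : ℕ → Seq
  gen n = ρpow n *S 𝕏

  _∗ρ_ : Seq → Seq → Seq
  a ∗ρ b = ρ a *S b +S a *S ρ b +S a *S b

  ρ̃ : Seq → Seq
  ρ̃ y = -S y +S -S (ρ y)

  ρ̃pow : ℕ → Seq
  ρ̃pow zero = 1S
  ρ̃pow (suc m) = ρ̃ (𝕏 *S ρ̃pow m)

  sumS : ℕ → (ℕ → Seq) → Seq
  sumS zero f = 0S
  sumS (suc n) f = sumS n f +S f n

  -- The antipode equation m ∘ (S ⊗ id) ∘ Δ_* = η ∘ ε evaluated on the generator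
  -- (ρX)^[n]X, with Δ_* as in the paper, S(1) = 1, 1 the adjoined ∗ρ-unit and
  -- ε((ρX)^[n]X) = 0:
  --   (ρX)^[n]X + Σ_{m=0}^{n-1} S((ρX)^[n-m-1]X) ∗ρ (ρX)^[m]X + S((ρX)^[n]X) = 0.
  -- Here S : ℕ → Seq gives the values S((ρX)^[n]X) of S on the generators.
  AntipodeOnGenerators : (ℕ → Seq) → Set ℓ
  AntipodeOnGenerators S =
    ∀ n → (gen n +S sumS n (λ m → S (n ∸ m ∸ 1) ∗ρ gen m) +S S n) ≈S 0S

{-# OPTIONS --safe #-}

-- The antipode equation on the generators determines S((ρX)^[n]X) from its values in lower
-- degrees, so it suffices that T n = -X(ρ̃X)^{n} satisfies it. Fix a component k, write x = xₖ₊₁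
-- and let p_m, q_j be the k-th components of (ρX)^[m] and (ρ̃X)^{j}. Since ρ(T j) = q_{j+1} + x q_j
-- in component k, the k-th component of T j ∗ρ (ρX)^[m]X is q_{j+1} p_m x - x q_j p_{m+1}, and
-- summing over j + m = n - 1 leaves c_n x - x c_n - p_n x + x q_n, where c_n = Σ_{j+m=n} q_j p_m.
-- So everything reduces to c_n commuting with x. For a central variable t, the recursions defining
-- ρ and ρ̃ = -id - ρ say that Σ p_m tᵐ = (1 + x₁ t) ⋯ (1 + xₖ t) and
-- Σ q_j tʲ = (1 + xₖ₊₁ t)⁻¹ ⋯ (1 + x₁ t)⁻¹, so Σ c_n tⁿ = (1 + x t)⁻¹, i.e. c_n = (-x)ⁿ.

module Submission where

open import Defs
open import Algebra.Bundles using (CommutativeRing; Ring; RawRing)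
open import Algebra.Structures using (IsRing)
open import Algebra.Morphism.Structures using (IsRingMonomorphism)
import Algebra.Construct.Pointwise as Pointwise
import Algebra.Morphism.RingMonomorphism as RingMonomorphism
open import Data.Nat as ℕ using (ℕ; zero; suc; _<_; _∸_)
open import Data.Nat.Induction using (<-rec)
open import Data.Nat.Properties using (≤-refl; m<n⇒m<1+n)
open import Data.List using ([]; _∷_; _++_; map)
open import Data.List.Properties using (≡-dec)
open import Data.Product using (_,_)
open import Relation.Nullary using (Dec; yes; no; contradiction)
open import Relation.Binary.PropositionalEquality as ≡ using (_≡_; _≢_)

module Polynomials {c ℓ} (K : CommutativeRing c ℓ) where
  open CommutativeRing K
  open Spitzer K
  open import Algebra.Properties.Ring ring using (-‿+-comm; -0#≈0#)
  open import Algebra.Properties.CommutativeSemigroup +-commutativeSemigroup using (interchange)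
  open import Relation.Binary.Reasoning.Setoid setoid

  coeff-++ : ∀ p q w → coeff (p ++ q) w ≈ coeff p w + coeff q w
  coeff-++ []            q w = sym (+-identityˡ _)
  coeff-++ ((a , u) ∷ p) q w with ≡-dec ℕ._≟_ u w
  ... | yes _ = trans (+-congˡ (coeff-++ p q w)) (sym (+-assoc _ _ _))
  ... | no  _ = coeff-++ p q w

  coeff-neg : ∀ p w → coeff (-P p) w ≈ - coeff p w
  coeff-neg []            w = sym -0#≈0#
  coeff-neg ((a , u) ∷ p) w with ≡-dec ℕ._≟_ u w
  ... | yes _ = trans (+-congˡ (coeff-neg p w)) (-‿+-comm a (coeff p w))
  ... | no  _ = coeff-neg p w

  Series : Set c
  Series = Word → Carrier

  _≈ₛ_ : Series → Series → Set ℓ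
  f ≈ₛ g = ∀ w → f w ≈ g w

  _⊕_ : Series → Series → Series
  (f ⊕ g) w = f w + g w

  ⊖_ : Series → Series
  (⊖ f) w = - f w

  0ₛ : Series
  0ₛ w = 0#

  monomial : Carrier → Word → Series
  monomial a u = coeff ((a , u) ∷ [])

  _⊛_ : Series → Series → Series
  (f ⊛ g) []      = f [] * g []
  (f ⊛ g) (i ∷ w) = f [] * g (i ∷ w) + ((λ u → f (i ∷ u)) ⊛ g) w

  open import Algebra.Definitions _≈ₛ_

  ⊛-cong : Congruent₂ _⊛_
  ⊛-cong f≈f′ g≈g′ []      = *-cong (f≈f′ []) (g≈g′ [])
  ⊛-cong f≈f′ g≈g′ (i ∷ w) = +-cong (*-cong (f≈f′ []) (g≈g′ (i ∷ w))) (⊛-cong (λ u → f≈f′ (i ∷ u)) g≈g′ w)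

  ⊛-zeroˡ : ∀ {f} g → f ≈ₛ 0ₛ → (f ⊛ g) ≈ₛ 0ₛ
  ⊛-zeroˡ g f≈0 []      = trans (*-congʳ (f≈0 [])) (zeroˡ _)
  ⊛-zeroˡ g f≈0 (i ∷ w) =
    trans (+-cong (trans (*-congʳ (f≈0 [])) (zeroˡ _)) (⊛-zeroˡ g (λ u → f≈0 (i ∷ u)) w)) (+-identityˡ 0#)

  ⊛-zeroʳ : ∀ f {g} → g ≈ₛ 0ₛ → (f ⊛ g) ≈ₛ 0ₛ
  ⊛-zeroʳ f g≈0 []      = trans (*-congˡ (g≈0 [])) (zeroʳ _)
  ⊛-zeroʳ f g≈0 (i ∷ w) =
    trans (+-cong (trans (*-congˡ (g≈0 (i ∷ w))) (zeroʳ _)) (⊛-zeroʳ (λ u → f (i ∷ u)) g≈0 w)) (+-identityˡ 0#)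

  ⊛-distribˡ-⊕ : _⊛_ DistributesOverˡ _⊕_
  ⊛-distribˡ-⊕ f g h []      = distribˡ _ _ _
  ⊛-distribˡ-⊕ f g h (i ∷ w) =
    trans (+-cong (distribˡ _ _ _) (⊛-distribˡ-⊕ (λ u → f (i ∷ u)) g h w)) (interchange _ _ _ _)

  ⊛-distribʳ-⊕ : _⊛_ DistributesOverʳ _⊕_
  ⊛-distribʳ-⊕ h f g []      = distribʳ _ _ _
  ⊛-distribʳ-⊕ h f g (i ∷ w) =
    trans (+-cong (distribʳ _ _ _) (⊛-distribʳ-⊕ h (λ u → f (i ∷ u)) (λ u → g (i ∷ u)) w)) (interchange _ _ _ _)

  *-⊛ : ∀ a f g w → ((λ u → a * f u) ⊛ g) w ≈ a * (f ⊛ g) w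
  *-⊛ a f g []      = *-assoc _ _ _
  *-⊛ a f g (i ∷ w) = trans (+-cong (*-assoc _ _ _) (*-⊛ a (λ u → f (i ∷ u)) g w)) (sym (distribˡ _ _ _))

  ⊛-assoc : Associative _⊛_
  ⊛-assoc f g h []      = *-assoc _ _ _
  ⊛-assoc f g h (i ∷ w) = begin
    (f [] * g []) * h (i ∷ w) + ((λ u → f [] * g (i ∷ u) + (f′ ⊛ g) u) ⊛ h) w
      ≈⟨ +-congˡ (⊛-distribʳ-⊕ h (λ u → f [] * g (i ∷ u)) (f′ ⊛ g) w) ⟩
    (f [] * g []) * h (i ∷ w) + (((λ u → f [] * g (i ∷ u)) ⊛ h) w + ((f′ ⊛ g) ⊛ h) w)
      ≈⟨ +-cong (*-assoc _ _ _) (+-cong (*-⊛ (f []) (λ u → g (i ∷ u)) h w) (⊛-assoc f′ g h w)) ⟩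
    f [] * (g [] * h (i ∷ w)) + (f [] * ((λ u → g (i ∷ u)) ⊛ h) w + (f′ ⊛ (g ⊛ h)) w)
      ≈⟨ +-assoc _ _ _ ⟨
    (f [] * (g [] * h (i ∷ w)) + f [] * ((λ u → g (i ∷ u)) ⊛ h) w) + (f′ ⊛ (g ⊛ h)) w
      ≈⟨ +-congʳ (distribˡ _ _ _) ⟨
    f [] * (g ⊛ h) (i ∷ w) + (f′ ⊛ (g ⊛ h)) w ∎
    where f′ = λ u → f (i ∷ u)

  monomial-≡ : ∀ a u → monomial a u u ≈ a
  monomial-≡ a u with ≡-dec ℕ._≟_ u u
  ... | yes _   = +-identityʳ a
  ... | no  u≢u = contradiction ≡.refl u≢u

  monomial-≢ : ∀ a u w → u ≢ w → monomial a u w ≈ 0#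
  monomial-≢ a u w u≢w with ≡-dec ℕ._≟_ u w
  ... | yes u≡w = contradiction u≡w u≢w
  ... | no  _   = refl

  *-monomial : ∀ a b v w → a * monomial b v w ≈ monomial (a * b) v w
  *-monomial a b v w with ≡-dec ℕ._≟_ v w
  ... | yes _ = trans (*-congˡ (+-identityʳ b)) (sym (+-identityʳ _))
  ... | no  _ = zeroʳ a

  monomial-∷ : ∀ a i u w → monomial a (i ∷ u) (i ∷ w) ≈ monomial a u w
  monomial-∷ a i u w = by-cases (≡-dec ℕ._≟_ u w)
    where
    by-cases : Dec (u ≡ w) → monomial a (i ∷ u) (i ∷ w) ≈ monomial a u w
    by-cases (yes ≡.refl) = trans (monomial-≡ a (i ∷ u)) (sym (monomial-≡ a u))
    by-cases (no u≢w)     =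
      trans (monomial-≢ a (i ∷ u) (i ∷ w) (λ { ≡.refl → u≢w ≡.refl })) (sym (monomial-≢ a u w u≢w))

  monomial[]-⊛ : ∀ a g w → (monomial a [] ⊛ g) w ≈ a * g w
  monomial[]-⊛ a g []      = *-congʳ (monomial-≡ a [])
  monomial[]-⊛ a g (i ∷ w) =
    trans (+-cong (*-congʳ (monomial-≡ a [])) (⊛-zeroˡ g (λ u → monomial-≢ a [] (i ∷ u) λ ()) w)) (+-identityʳ _)

  monomial-∷-⊛ : ∀ a i u g j w →
                 (monomial a (i ∷ u) ⊛ g) (j ∷ w) ≈ ((λ z → monomial a (i ∷ u) (j ∷ z)) ⊛ g) w
  monomial-∷-⊛ a i u g j w =
    trans (+-congʳ (trans (*-congʳ (monomial-≢ a (i ∷ u) [] λ ())) (zeroˡ _))) (+-identityˡ _)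

  monomial-⊛-monomial : ∀ a u b v w → monomial (a * b) (u ++ v) w ≈ (monomial a u ⊛ monomial b v) w
  monomial-⊛-monomial a []      b v w =
    trans (sym (*-monomial a b v w)) (sym (monomial[]-⊛ a (monomial b v) w))
  monomial-⊛-monomial a (i ∷ u) b v [] =
    trans (monomial-≢ (a * b) (i ∷ u ++ v) [] λ ())
          (sym (trans (*-congʳ (monomial-≢ a (i ∷ u) [] λ ())) (zeroˡ _)))
  monomial-⊛-monomial a (i ∷ u) b v (j ∷ w) = by-cases (i ℕ.≟ j)
    where
    by-cases : Dec (i ≡ j) →
               monomial (a * b) (i ∷ u ++ v) (j ∷ w) ≈ (monomial a (i ∷ u) ⊛ monomial b v) (j ∷ w)
    by-cases (yes ≡.refl) = begin
      monomial (a * b) (i ∷ u ++ v) (i ∷ w)                 ≈⟨ monomial-∷ (a * b) i (u ++ v) w ⟩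
      monomial (a * b) (u ++ v) w                           ≈⟨ monomial-⊛-monomial a u b v w ⟩
      (monomial a u ⊛ monomial b v) w                       ≈⟨ ⊛-cong (monomial-∷ a i u) (λ _ → refl) w ⟨
      ((λ z → monomial a (i ∷ u) (i ∷ z)) ⊛ monomial b v) w ≈⟨ monomial-∷-⊛ a i u (monomial b v) i w ⟨
      (monomial a (i ∷ u) ⊛ monomial b v) (i ∷ w)           ∎
    by-cases (no i≢j) =
      trans (monomial-≢ (a * b) (i ∷ u ++ v) (j ∷ w) i∷≢j∷)
            (sym (trans (monomial-∷-⊛ a i u (monomial b v) j w)
                        (⊛-zeroˡ (monomial b v) (λ z → monomial-≢ a (i ∷ u) (j ∷ z) i∷≢j∷) w)))
      where
      i∷≢j∷ : ∀ {u′ w′} → i ∷ u′ ≢ j ∷ w′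
      i∷≢j∷ ≡.refl = i≢j ≡.refl

  coeff-monomial*P : ∀ a u q w → coeff (((a , u) ∷ []) *P q) w ≈ (monomial a u ⊛ coeff q) w
  coeff-monomial*P a u []            w = sym (⊛-zeroʳ (monomial a u) (λ _ → refl) w)
  coeff-monomial*P a u ((b , v) ∷ q) w = begin
    coeff ((a * b , u ++ v) ∷ (((a , u) ∷ []) *P q)) w
      ≈⟨ coeff-++ ((a * b , u ++ v) ∷ []) (((a , u) ∷ []) *P q) w ⟩
    monomial (a * b) (u ++ v) w + coeff (((a , u) ∷ []) *P q) w
      ≈⟨ +-cong (monomial-⊛-monomial a u b v w) (coeff-monomial*P a u q w) ⟩
    (monomial a u ⊛ monomial b v) w + (monomial a u ⊛ coeff q) w
      ≈⟨ ⊛-distribˡ-⊕ (monomial a u) (monomial b v) (coeff q) w ⟨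
    (monomial a u ⊛ (monomial b v ⊕ coeff q)) w
      ≈⟨ ⊛-cong (λ _ → refl) (λ z → sym (coeff-++ ((b , v) ∷ []) q z)) w ⟩
    (monomial a u ⊛ coeff ((b , v) ∷ q)) w ∎

  coeff-∷-*P : ∀ a u p q w →
               coeff (((a , u) ∷ p) *P q) w ≈ coeff (((a , u) ∷ []) *P q) w + coeff (p *P q) w
  coeff-∷-*P a u p q w =
    trans (coeff-++ uq (p *P q) w) (+-congʳ (sym (trans (coeff-++ uq [] w) (+-identityʳ _))))
    where uq = map (λ { (b , v) → (a * b , u ++ v) }) q

  coeff-*P : ∀ p q w → coeff (p *P q) w ≈ (coeff p ⊛ coeff q) w
  coeff-*P []            q w = sym (⊛-zeroˡ (coeff q) (λ _ → refl) w)
  coeff-*P ((a , u) ∷ p) q w = begin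
    coeff (((a , u) ∷ p) *P q) w
      ≈⟨ coeff-∷-*P a u p q w ⟩
    coeff (((a , u) ∷ []) *P q) w + coeff (p *P q) w
      ≈⟨ +-cong (coeff-monomial*P a u q w) (coeff-*P p q w) ⟩
    (monomial a u ⊛ coeff q) w + (coeff p ⊛ coeff q) w
      ≈⟨ ⊛-distribʳ-⊕ (coeff q) (monomial a u) (coeff p) w ⟨
    ((monomial a u ⊕ coeff p) ⊛ coeff q) w
      ≈⟨ ⊛-cong (λ z → sym (coeff-++ ((a , u) ∷ []) p z)) (λ _ → refl) w ⟩
    (coeff ((a , u) ∷ p) ⊛ coeff q) w ∎

  ⊛-identityˡ : LeftIdentity (monomial 1# []) _⊛_
  ⊛-identityˡ f w = trans (monomial[]-⊛ 1# f w) (*-identityˡ (f w))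

  ⊛-identityʳ : RightIdentity (monomial 1# []) _⊛_
  ⊛-identityʳ f []      = trans (*-congˡ (monomial-≡ 1# [])) (*-identityʳ _)
  ⊛-identityʳ f (i ∷ w) = begin
    f [] * monomial 1# [] (i ∷ w) + ((λ u → f (i ∷ u)) ⊛ monomial 1# []) w
      ≈⟨ +-cong (*-congˡ (monomial-≢ 1# [] (i ∷ w) λ ())) (⊛-identityʳ (λ u → f (i ∷ u)) w) ⟩
    f [] * 0# + f (i ∷ w) ≈⟨ +-congʳ (zeroʳ _) ⟩
    0# + f (i ∷ w)        ≈⟨ +-identityˡ _ ⟩
    f (i ∷ w)             ∎

  ⊛-isRing : IsRing _≈ₛ_ _⊕_ _⊛_ ⊖_ 0ₛ (monomial 1# [])
  ⊛-isRing = record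
    { +-isAbelianGroup = Pointwise.isAbelianGroup Word +-isAbelianGroup
    ; *-cong           = ⊛-cong
    ; *-assoc          = ⊛-assoc
    ; *-identity       = ⊛-identityˡ , ⊛-identityʳ
    ; distrib          = ⊛-distribˡ-⊕ , ⊛-distribʳ-⊕
    }

  -- ≈P wrapped in a record, so that p and q can be inferred from p ≋ q.
  record _≋_ (p q : Poly) : Set ℓ where
    constructor by-coeff
    field coeffs : p ≈P q
  open _≋_ public

  series-rawRing : RawRing c ℓ
  series-rawRing = record
    { Carrier = Series ; _≈_ = _≈ₛ_ ; _+_ = _⊕_ ; _*_ = _⊛_ ; -_ = ⊖_ ; 0# = 0ₛ ; 1# = monomial 1# [] }

  poly-rawRing : RawRing c ℓ
  poly-rawRing = record
    { Carrier = Poly ; _≈_ = _≋_ ; _+_ = _+P_ ; _*_ = _*P_ ; -_ = -P_ ; 0# = 0P ; 1# = 1P }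

  coeff-isRingMonomorphism : IsRingMonomorphism poly-rawRing series-rawRing coeff
  coeff-isRingMonomorphism = record
    { isRingHomomorphism = record
      { isSemiringHomomorphism = record
        { isNearSemiringHomomorphism = record
          { +-isMonoidHomomorphism = record
            { isMagmaHomomorphism = record
              { isRelHomomorphism = record { cong = coeffs }
              ; homo              = coeff-++
              }
            ; ε-homo = λ _ → refl
            }
          ; *-homo = coeff-*P
          }
        ; 1#-homo = λ _ → refl
        }
      ; -‿homo = coeff-neg
      }
    ; injective = by-coeff
    }

  polyRing : Ring c ℓ
  polyRing = record
    { Carrier = Poly
    ; _≈_    = _≋_
    ; _+_    = _+P_
    ; _*_    = _*P_
    ; -_     = -P_
    ; 0#     = 0P
    ; 1#     = 1P
    ; isRing = RingMonomorphism.isRing coeff-isRingMonomorphism ⊛-isRing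
    }

module PowerSeries {c ℓ} (R : Ring c ℓ) where
  open Ring R
  open import Algebra.Properties.Ring R
  open import Algebra.Properties.CommutativeSemigroup +-commutativeSemigroup
    using (interchange; x∙yz≈y∙xz; xy∙z≈y∙zx)
  open import Relation.Binary.Reasoning.Setoid setoid

  -- antidiagonalSum n h = Σ_{j + m + 1 = n} h j m
  antidiagonalSum : ℕ → (ℕ → ℕ → Carrier) → Carrier
  antidiagonalSum zero    h = 0#
  antidiagonalSum (suc n) h = h n 0 + antidiagonalSum n (λ j m → h j (suc m))

  antidiagonalSum-cong : ∀ n {h h′ : ℕ → ℕ → Carrier} → (∀ j m → j < n → h j m ≈ h′ j m) →
                         antidiagonalSum n h ≈ antidiagonalSum n h′
  antidiagonalSum-cong zero    h≈h′ = refl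
  antidiagonalSum-cong (suc n) h≈h′ =
    +-cong (h≈h′ n 0 ≤-refl) (antidiagonalSum-cong n (λ j m j<n → h≈h′ j (suc m) (m<n⇒m<1+n j<n)))

  antidiagonalSum-suc : ∀ n h → antidiagonalSum (suc n) h ≈ h 0 n + antidiagonalSum n (λ j m → h (suc j) m)
  antidiagonalSum-suc zero    h = refl
  antidiagonalSum-suc (suc n) h = begin
    h (suc n) 0 + antidiagonalSum (suc n) (λ j m → h j (suc m))
      ≈⟨ +-congˡ (antidiagonalSum-suc n (λ j m → h j (suc m))) ⟩
    h (suc n) 0 + (h 0 (suc n) + antidiagonalSum n (λ j m → h (suc j) (suc m)))
      ≈⟨ x∙yz≈y∙xz _ _ _ ⟩
    h 0 (suc n) + (h (suc n) 0 + antidiagonalSum n (λ j m → h (suc j) (suc m))) ∎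

  antidiagonalSum-+ : ∀ n h h′ → antidiagonalSum n (λ j m → h j m + h′ j m) ≈
                                antidiagonalSum n h + antidiagonalSum n h′
  antidiagonalSum-+ zero    h h′ = sym (+-identityʳ 0#)
  antidiagonalSum-+ (suc n) h h′ =
    trans (+-congˡ (antidiagonalSum-+ n _ _)) (interchange _ _ _ _)

  antidiagonalSum-*ˡ : ∀ n y h → antidiagonalSum n (λ j m → y * h j m) ≈ y * antidiagonalSum n h
  antidiagonalSum-*ˡ zero    y h = sym (zeroʳ y)
  antidiagonalSum-*ˡ (suc n) y h = trans (+-congˡ (antidiagonalSum-*ˡ n y _)) (sym (distribˡ _ _ _))

  antidiagonalSum-*ʳ : ∀ n y h → antidiagonalSum n (λ j m → h j m * y) ≈ antidiagonalSum n h * y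
  antidiagonalSum-*ʳ zero    y h = sym (zeroˡ y)
  antidiagonalSum-*ʳ (suc n) y h = trans (+-congˡ (antidiagonalSum-*ʳ n y _)) (sym (distribʳ _ _ _))

  -- Coefficient sequences of power series in a central variable t.
  _⋆_ : (ℕ → Carrier) → (ℕ → Carrier) → ℕ → Carrier
  (a ⋆ b) n = antidiagonalSum (suc n) (λ j m → a j * b m)

  unitSeries : ℕ → Carrier
  unitSeries zero    = 1#
  unitSeries (suc n) = 0#

  -- (1 + y t) a  and  b (1 + y t)
  onePlusˡ onePlusʳ : Carrier → (ℕ → Carrier) → ℕ → Carrier
  onePlusˡ y a zero    = a 0
  onePlusˡ y a (suc n) = a (suc n) + y * a n
  onePlusʳ y b zero    = b 0
  onePlusʳ y b (suc n) = b (suc n) + b n * y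

  -- (1 + y t)⁻¹ = Σ (- y)ⁿ tⁿ
  geometric : Carrier → ℕ → Carrier
  geometric y zero    = 1#
  geometric y (suc n) = - (y * geometric y n)

  ⋆-cong : ∀ {a a′ b b′} → (∀ m → a m ≈ a′ m) → (∀ m → b m ≈ b′ m) → ∀ n → (a ⋆ b) n ≈ (a′ ⋆ b′) n
  ⋆-cong a≈a′ b≈b′ n = antidiagonalSum-cong (suc n) (λ j m _ → *-cong (a≈a′ j) (b≈b′ m))

  ⋆-unitʳ : ∀ a n → (a ⋆ unitSeries) n ≈ a n
  ⋆-unitʳ a n = begin
    a n * 1# + antidiagonalSum n (λ j m → a j * 0#)
      ≈⟨ +-cong (*-identityʳ (a n)) (antidiagonalSum-*ʳ n 0# (λ j m → a j)) ⟩
    a n + antidiagonalSum n (λ j m → a j) * 0# ≈⟨ +-congˡ (zeroʳ _) ⟩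
    a n + 0#                                   ≈⟨ +-identityʳ (a n) ⟩
    a n                                        ∎

  ⋆-onePlusˡ : ∀ y a b n → (onePlusˡ y a ⋆ b) n ≈ onePlusˡ y (a ⋆ b) n
  ⋆-onePlusˡ y a b zero    = refl
  ⋆-onePlusˡ y a b (suc n) = begin
    (onePlusˡ y a ⋆ b) (suc n)
      ≈⟨ antidiagonalSum-suc (suc n) (λ j m → onePlusˡ y a j * b m) ⟩
    a 0 * b (suc n) + antidiagonalSum (suc n) (λ j m → (a (suc j) + y * a j) * b m)
      ≈⟨ +-congˡ (antidiagonalSum-cong (suc n) λ j m _ →
           trans (distribʳ (b m) (a (suc j)) (y * a j)) (+-congˡ (*-assoc y (a j) (b m)))) ⟩
    a 0 * b (suc n) + antidiagonalSum (suc n) (λ j m → a (suc j) * b m + y * (a j * b m))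
      ≈⟨ +-congˡ (trans (antidiagonalSum-+ (suc n) (λ j m → a (suc j) * b m) (λ j m → y * (a j * b m)))
                        (+-congˡ (antidiagonalSum-*ˡ (suc n) y (λ j m → a j * b m)))) ⟩
    a 0 * b (suc n) + (antidiagonalSum (suc n) (λ j m → a (suc j) * b m) + y * (a ⋆ b) n)
      ≈⟨ +-assoc _ _ _ ⟨
    (a 0 * b (suc n) + antidiagonalSum (suc n) (λ j m → a (suc j) * b m)) + y * (a ⋆ b) n
      ≈⟨ +-congʳ (antidiagonalSum-suc (suc n) (λ j m → a j * b m)) ⟨
    (a ⋆ b) (suc n) + y * (a ⋆ b) n ∎

  ⋆-onePlusʳ : ∀ y a b n → (a ⋆ onePlusʳ y b) n ≈ onePlusʳ y (a ⋆ b) n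
  ⋆-onePlusʳ y a b zero    = refl
  ⋆-onePlusʳ y a b (suc n) = begin
    a (suc n) * b 0 + antidiagonalSum (suc n) (λ j m → a j * (b (suc m) + b m * y))
      ≈⟨ +-congˡ (antidiagonalSum-cong (suc n) λ j m _ →
           trans (distribˡ (a j) (b (suc m)) (b m * y)) (+-congˡ (sym (*-assoc (a j) (b m) y)))) ⟩
    a (suc n) * b 0 + antidiagonalSum (suc n) (λ j m → a j * b (suc m) + (a j * b m) * y)
      ≈⟨ +-congˡ (trans (antidiagonalSum-+ (suc n) (λ j m → a j * b (suc m)) (λ j m → (a j * b m) * y))
                        (+-congˡ (antidiagonalSum-*ʳ (suc n) y (λ j m → a j * b m)))) ⟩
    a (suc n) * b 0 + (antidiagonalSum (suc n) (λ j m → a j * b (suc m)) + (a ⋆ b) n * y)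
      ≈⟨ +-assoc _ _ _ ⟨
    (a ⋆ b) (suc n) + (a ⋆ b) n * y ∎

  onePlusʳ-cong : ∀ y {a b} → (∀ m → a m ≈ b m) → ∀ n → onePlusʳ y a n ≈ onePlusʳ y b n
  onePlusʳ-cong y a≈b zero    = a≈b 0
  onePlusʳ-cong y a≈b (suc n) = +-cong (a≈b (suc n)) (*-congʳ (a≈b n))

  geometric-comm : ∀ y n → geometric y n * y ≈ y * geometric y n
  geometric-comm y zero    = trans (*-identityˡ y) (sym (*-identityʳ y))
  geometric-comm y (suc n) = begin
    - (y * g) * y   ≈⟨ -‿distribˡ-* _ _ ⟨
    - ((y * g) * y) ≈⟨ -‿cong (*-assoc _ _ _) ⟩
    - (y * (g * y)) ≈⟨ -‿cong (*-congˡ (geometric-comm y n)) ⟩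
    - (y * (y * g)) ≈⟨ -‿distribʳ-* _ _ ⟩
    y * - (y * g)   ∎
    where g = geometric y n

  onePlusʳ-geometric : ∀ y n → onePlusʳ y (geometric y) n ≈ unitSeries n
  onePlusʳ-geometric y zero    = refl
  onePlusʳ-geometric y (suc n) = trans (+-congˡ (geometric-comm y n)) (-‿inverseˡ _)

  onePlusˡ≈unit⇒geometric : ∀ y a → (∀ n → onePlusˡ y a n ≈ unitSeries n) → ∀ n → a n ≈ geometric y n
  onePlusˡ≈unit⇒geometric y a eq zero    = eq 0
  onePlusˡ≈unit⇒geometric y a eq (suc n) =
    trans (+-inverseˡ-unique _ _ (eq (suc n))) (-‿cong (*-congˡ (onePlusˡ≈unit⇒geometric y a eq n)))

  -- P m k, Q j k and B j k stand for the k-th components of (ρX)^[m], (ρ̃X)^{j} and ρ(X(ρ̃X)^{j}),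
  -- and x k for x_{k+1}; the hypotheses are their defining recursions.
  module SpitzerComponents
    (x : ℕ → Carrier) (P Q B : ℕ → ℕ → Carrier)
    (P-zero    : ∀ k → P 0 k ≈ 1#)
    (P-initial : ∀ m → P (suc m) 0 ≈ 0#)
    (P-step    : ∀ m k → P (suc m) (suc k) ≈ P (suc m) k + P m k * x k)
    (Q-zero    : ∀ k → Q 0 k ≈ 1#)
    (Q-suc     : ∀ j k → Q (suc j) k ≈ - (x k * Q j k) + - B j k)
    (B-initial : ∀ j → B j 0 ≈ 0#)
    (B-step    : ∀ j k → B j (suc k) ≈ B j k + x k * Q j k)
    where

    Pₜ Qₜ : ℕ → ℕ → Carrier
    Pₜ k m = P m k
    Qₜ k j = Q j k

    Q-suc+xQ : ∀ j k → Q (suc j) k + x k * Q j k ≈ - B j k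
    Q-suc+xQ j k = begin
      Q (suc j) k + x k * Q j k                 ≈⟨ +-congʳ (Q-suc j k) ⟩
      (- (x k * Q j k) + - B j k) + x k * Q j k ≈⟨ xy∙z≈y∙zx _ _ _ ⟩
      - B j k + (x k * Q j k - x k * Q j k)     ≈⟨ +-congˡ (-‿inverseʳ _) ⟩
      - B j k + 0#                              ≈⟨ +-identityʳ _ ⟩
      - B j k                                   ∎

    Pₜ-initial : ∀ m → Pₜ 0 m ≈ unitSeries m
    Pₜ-initial zero    = P-zero 0
    Pₜ-initial (suc m) = P-initial m

    Pₜ-step : ∀ k m → Pₜ (suc k) m ≈ onePlusʳ (x k) (Pₜ k) m
    Pₜ-step k zero    = trans (P-zero (suc k)) (sym (P-zero k))
    Pₜ-step k (suc m) = P-step m k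

    Qₜ-initial : ∀ j → onePlusˡ (x 0) (Qₜ 0) j ≈ unitSeries j
    Qₜ-initial zero    = Q-zero 0
    Qₜ-initial (suc j) = trans (Q-suc+xQ j 0) (trans (-‿cong (B-initial j)) -0#≈0#)

    Qₜ-step : ∀ k j → onePlusˡ (x (suc k)) (Qₜ (suc k)) j ≈ Qₜ k j
    Qₜ-step k zero    = trans (Q-zero (suc k)) (sym (Q-zero k))
    Qₜ-step k (suc j) = begin
      Q (suc j) (suc k) + x (suc k) * Q j (suc k) ≈⟨ Q-suc+xQ j (suc k) ⟩
      - B j (suc k)                               ≈⟨ -‿cong (trans (B-step j k) (+-comm _ _)) ⟩
      - (x k * Q j k + B j k)                     ≈⟨ -‿+-comm _ _ ⟨
      - (x k * Q j k) + - B j k                   ≈⟨ Q-suc j k ⟨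
      Q (suc j) k                                 ∎

    Qₜ⋆Pₜ : ∀ k n → (Qₜ k ⋆ Pₜ k) n ≈ geometric (x k) n
    Qₜ⋆Pₜ zero    n = begin
      (Qₜ 0 ⋆ Pₜ 0) n        ≈⟨ ⋆-cong (λ _ → refl) Pₜ-initial n ⟩
      (Qₜ 0 ⋆ unitSeries) n  ≈⟨ ⋆-unitʳ (Qₜ 0) n ⟩
      Qₜ 0 n                 ≈⟨ onePlusˡ≈unit⇒geometric (x 0) (Qₜ 0) Qₜ-initial n ⟩
      geometric (x 0) n      ∎
    Qₜ⋆Pₜ (suc k) = onePlusˡ≈unit⇒geometric (x (suc k)) (Qₜ (suc k) ⋆ Pₜ (suc k)) λ n → begin
      onePlusˡ (x (suc k)) (Qₜ (suc k) ⋆ Pₜ (suc k)) n ≈⟨ ⋆-onePlusˡ (x (suc k)) (Qₜ (suc k)) (Pₜ (suc k)) n ⟨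
      (onePlusˡ (x (suc k)) (Qₜ (suc k)) ⋆ Pₜ (suc k)) n ≈⟨ ⋆-cong (Qₜ-step k) (Pₜ-step k) n ⟩
      (Qₜ k ⋆ onePlusʳ (x k) (Pₜ k)) n                ≈⟨ ⋆-onePlusʳ (x k) (Qₜ k) (Pₜ k) n ⟩
      onePlusʳ (x k) (Qₜ k ⋆ Pₜ k) n                  ≈⟨ onePlusʳ-cong (x k) (Qₜ⋆Pₜ k) n ⟩
      onePlusʳ (x k) (geometric (x k)) n              ≈⟨ onePlusʳ-geometric (x k) n ⟩
      unitSeries n                                    ∎

    -- The k-th component of (-X(ρ̃X)^{j}) ∗ρ ((ρX)^[m]X).
    antipodeSummand : ℕ → ℕ → ℕ → Carrier
    antipodeSummand j m k =
      - B j k * (P m k * x k) + - (x k * Q j k) * P (suc m) k + - (x k * Q j k) * (P m k * x k)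

    antipodeSummand-telescopes : ∀ j m k →
      antipodeSummand j m k + x k * (Q j k * P (suc m) k) ≈ (Q (suc j) k * P m k) * x k
    antipodeSummand-telescopes j m k = begin
      ((- B′ * Px + - xQ * P′) + - xQ * Px) + x k * (Q j k * P′) ≈⟨ +-assoc _ _ _ ⟩
      (- B′ * Px + - xQ * P′) + (- xQ * Px + x k * (Q j k * P′)) ≈⟨ interchange _ _ _ _ ⟩
      (- B′ * Px + - xQ * Px) + (- xQ * P′ + x k * (Q j k * P′)) ≈⟨ +-cong (sym (distribʳ _ _ _)) cancel ⟩
      (- B′ + - xQ) * Px + 0#                                   ≈⟨ +-identityʳ _ ⟩
      (- B′ + - xQ) * Px                                        ≈⟨ *-congʳ (trans (+-comm _ _) (sym (Q-suc j k))) ⟩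
      Q (suc j) k * (P m k * x k)                               ≈⟨ *-assoc _ _ _ ⟨
      (Q (suc j) k * P m k) * x k                               ∎
      where
      B′ = B j k
      xQ = x k * Q j k
      Px = P m k * x k
      P′ = P (suc m) k
      cancel : - xQ * P′ + x k * (Q j k * P′) ≈ 0#
      cancel = trans (+-cong (sym (-‿distribˡ-* xQ P′)) (sym (*-assoc _ _ _))) (-‿inverseˡ _)

    antipodeSum : ∀ n k → P n k * x k + antidiagonalSum n (λ j m → antipodeSummand j m k) ≈ x k * Q n k
    antipodeSum n k = +-cancelʳ (x k * Σ₂) _ _ (begin
      (P n k * x k + antidiagonalSum n (λ j m → antipodeSummand j m k)) + x k * Σ₂
        ≈⟨ +-assoc _ _ _ ⟩
      P n k * x k + (antidiagonalSum n (λ j m → antipodeSummand j m k) + x k * Σ₂)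
        ≈⟨ +-congˡ (+-congˡ (antidiagonalSum-*ˡ n (x k) (λ j m → Q j k * P (suc m) k))) ⟨
      P n k * x k + (antidiagonalSum n (λ j m → antipodeSummand j m k)
                     + antidiagonalSum n (λ j m → x k * (Q j k * P (suc m) k)))
        ≈⟨ +-congˡ (antidiagonalSum-+ n (λ j m → antipodeSummand j m k) (λ j m → x k * (Q j k * P (suc m) k))) ⟨
      P n k * x k + antidiagonalSum n (λ j m → antipodeSummand j m k + x k * (Q j k * P (suc m) k))
        ≈⟨ +-congˡ (antidiagonalSum-cong n (λ j m _ → antipodeSummand-telescopes j m k)) ⟩
      P n k * x k + antidiagonalSum n (λ j m → (Q (suc j) k * P m k) * x k)
        ≈⟨ +-congˡ (antidiagonalSum-*ʳ n (x k) (λ j m → Q (suc j) k * P m k)) ⟩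
      P n k * x k + Σ₁ * x k ≈⟨ distribʳ _ _ _ ⟨
      (P n k + Σ₁) * x k     ≈⟨ *-congʳ C≈P+Σ₁ ⟨
      C * x k                ≈⟨ C-comm ⟩
      x k * C                ≈⟨ *-congˡ C≈Q+Σ₂ ⟩
      x k * (Q n k + Σ₂)     ≈⟨ distribˡ _ _ _ ⟩
      x k * Q n k + x k * Σ₂ ∎)
      where
      C  = (Qₜ k ⋆ Pₜ k) n
      Σ₁ = antidiagonalSum n (λ j m → Q (suc j) k * P m k)
      Σ₂ = antidiagonalSum n (λ j m → Q j k * P (suc m) k)
      C≈P+Σ₁ : C ≈ P n k + Σ₁
      C≈P+Σ₁ = trans (antidiagonalSum-suc n (λ j m → Q j k * P m k))
                     (+-congʳ (trans (*-congʳ (Q-zero k)) (*-identityˡ _)))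
      C≈Q+Σ₂ : C ≈ Q n k + Σ₂
      C≈Q+Σ₂ = +-congʳ (trans (*-congˡ (P-zero k)) (*-identityʳ _))
      C-comm : C * x k ≈ x k * C
      C-comm = trans (*-congʳ (Qₜ⋆Pₜ k n)) (trans (geometric-comm (x k) n) (*-congˡ (sym (Qₜ⋆Pₜ k n))))

module Antipode {c ℓ} (K : CommutativeRing c ℓ) where
  open Spitzer K
  open Polynomials K using (polyRing; by-coeff; coeffs)
  open Ring polyRing
  open import Algebra.Properties.Ring polyRing using (-‿+-comm; +-inverseʳ-unique)
  open import Relation.Binary.Reasoning.Setoid setoid
  open PowerSeries polyRing using (antidiagonalSum; antidiagonalSum-cong)
  open PowerSeries.SpitzerComponents polyRing
    var (λ m k → ρpow m k) (λ j k → ρ̃pow j k) (λ j k → ρ (𝕏 *S ρ̃pow j) k)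
    (λ _ → refl) (λ _ → refl) (λ _ _ → refl) (λ _ → refl) (λ _ _ → refl) (λ _ → refl) (λ _ _ → refl)

  ρ-cong : ∀ {a b} → (∀ k → a k ≈ b k) → ∀ k → ρ a k ≈ ρ b k
  ρ-cong a≈b zero    = refl
  ρ-cong a≈b (suc k) = +-cong (ρ-cong a≈b k) (a≈b k)

  ρ-neg : ∀ a k → ρ (-S a) k ≈ - ρ a k
  ρ-neg a zero    = refl
  ρ-neg a (suc k) = trans (+-congʳ (ρ-neg a k)) (-‿+-comm (ρ a k) (a k))

  ∗ρ-congˡ : ∀ {a a′} b → (∀ k → a k ≈ a′ k) → ∀ k → (a ∗ρ b) k ≈ (a′ ∗ρ b) k
  ∗ρ-congˡ b a≈a′ k = +-cong (+-cong (*-congʳ (ρ-cong a≈a′ k)) (*-congʳ (a≈a′ k))) (*-congʳ (a≈a′ k))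

  sumS-suc : ∀ n f k → sumS (suc n) f k ≈ f 0 k + sumS n (λ m → f (suc m)) k
  sumS-suc zero    f k = sym (+-identityʳ (f 0 k))
  sumS-suc (suc n) f k =
    trans (+-congʳ (sumS-suc n f k)) (+-assoc (f 0 k) (sumS n (λ m → f (suc m)) k) (f (suc n) k))

  sumS-antidiagonal : ∀ n (h : ℕ → ℕ → Seq) k →
                      sumS n (λ m → h (n ∸ m ∸ 1) m) k ≈ antidiagonalSum n (λ j m → h j m k)
  sumS-antidiagonal zero    h k = refl
  sumS-antidiagonal (suc n) h k =
    trans (sumS-suc n (λ m → h (suc n ∸ m ∸ 1) m) k) (+-congˡ (sumS-antidiagonal n (λ j m → h j (suc m)) k))

  antipode-recursion : ∀ {S} → AntipodeOnGenerators S →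
    ∀ n k → S n k ≈ - (gen n k + antidiagonalSum n (λ j m → (S j ∗ρ gen m) k))
  antipode-recursion {S} isAntipode n k =
    trans (+-inverseʳ-unique _ _ (by-coeff (isAntipode n k)))
          (-‿cong (+-congˡ (sumS-antidiagonal n (λ j m → S j ∗ρ gen m) k)))

  antipode-unique : ∀ {S S′} → AntipodeOnGenerators S → AntipodeOnGenerators S′ → ∀ n k → S n k ≈ S′ n k
  antipode-unique {S} {S′} isAntipode isAntipode′ = <-rec _ λ n S≈S′ k → begin
    S n k                                                      ≈⟨ antipode-recursion isAntipode n k ⟩
    - (gen n k + antidiagonalSum n (λ j m → (S j ∗ρ gen m) k))
      ≈⟨ -‿cong (+-congˡ (antidiagonalSum-cong n λ j m j<n → ∗ρ-congˡ (gen m) (S≈S′ j<n) k)) ⟩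
    - (gen n k + antidiagonalSum n (λ j m → (S′ j ∗ρ gen m) k)) ≈⟨ antipode-recursion isAntipode′ n k ⟨
    S′ n k                                                     ∎

  negXρ̃pow : ℕ → Seq
  negXρ̃pow n = -S (𝕏 *S ρ̃pow n)

  negXρ̃pow-∗ρ-gen : ∀ j m k → (negXρ̃pow j ∗ρ gen m) k ≈ antipodeSummand j m k
  negXρ̃pow-∗ρ-gen j m k = +-congʳ (+-congʳ (*-congʳ (ρ-neg (𝕏 *S ρ̃pow j) k)))

  negXρ̃pow-isAntipode : AntipodeOnGenerators negXρ̃pow
  negXρ̃pow-isAntipode n k = coeffs (begin
    (gen n k + sumS n (λ m → negXρ̃pow (n ∸ m ∸ 1) ∗ρ gen m) k) + negXρ̃pow n k
      ≈⟨ +-congʳ {negXρ̃pow n k} (+-congˡ {gen n k} (sumS-antidiagonal n (λ j m → negXρ̃pow j ∗ρ gen m) k)) ⟩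
    (gen n k + antidiagonalSum n (λ j m → (negXρ̃pow j ∗ρ gen m) k)) + negXρ̃pow n k
      ≈⟨ +-congʳ {negXρ̃pow n k} (+-congˡ {gen n k} (antidiagonalSum-cong n (λ j m _ → negXρ̃pow-∗ρ-gen j m k))) ⟩
    (gen n k + antidiagonalSum n (λ j m → antipodeSummand j m k)) + - (var k * ρ̃pow n k)
      ≈⟨ +-congʳ {negXρ̃pow n k} (antipodeSum n k) ⟩
    var k * ρ̃pow n k + - (var k * ρ̃pow n k)
      ≈⟨ -‿inverseʳ (var k * ρ̃pow n k) ⟩
    0# ∎)

mainTheorem7 : ∀ {c ℓ} (K : CommutativeRing c ℓ) → IsFieldCR K → CharZero K →
    let open Spitzer K in
    (S : ℕ → Seq) → AntipodeOnGenerators S →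
    ∀ n → S n ≈S (-S (𝕏 *S ρ̃pow n))
mainTheorem7 K _ _ S isAntipode n k = coeffs (antipode-unique isAntipode negXρ̃pow-isAntipode n k)
  where open Antipode K
        open Polynomials K using (coeffs)
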